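{- If $D$ is an orientation of a triangle-free graph, then $D$ has a Sullivan vertex, i.e. a vertex $u$ with $|N^{++}(u)|\ge |N^-(u)|$.
   Context: An orientation of a simple graph $G$ replaces each edge by exactly one of its two arcs, giving an oriented graph $D=(V,A)$. $N^-(u)=\{v: vu\in A\}$, $N^+(u)=\{v:uv\in A\}$, $N^{++}(u)=\{v\in V: uw,wv\in A \text{ for some } w\}\setminus N^+(u)$. -}

module Defs where

open import Data.Nat using (ℕ; suc; _≥_)
open import Data.Bool using (Bool; true; false; _∧_; _∨_; not; T)
open import Data.Fin using (Fin)
open import Data.Fin.Subset using (Subset; ∣_∣)
open import Data.Vec using (tabulate)
open import Data.Sum using (_⊎_)
open import Data.Product using (_×_; ∃)
open import Relation.Nullary using (¬_)

anyFin : ∀ {n} → (Fin n → Bool) → Bool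
anyFin {ℕ.zero} p = false
anyFin {suc n} p = p Fin.zero ∨ anyFin (λ i → p (Fin.suc i))

Digraph : ℕ → Set
Digraph n = Fin n → Fin n → Bool

Arc : ∀ {n} → Digraph n → Fin n → Fin n → Set
Arc D u v = T (D u v)

-- D is an oriented graph, i.e. an orientation of a simple graph:
-- no loops and no pair of opposite arcs (each edge gets exactly one arc).
IsOriented : ∀ {n} → Digraph n → Set
IsOriented D = (∀ u → ¬ Arc D u u) × (∀ u v → ¬ (Arc D u v × Arc D v u))

Adj : ∀ {n} → Digraph n → Fin n → Fin n → Set
Adj D u v = Arc D u v ⊎ Arc D v u

UnderlyingTriangleFree : ∀ {n} → Digraph n → Set
UnderlyingTriangleFree D = ∀ x y z → ¬ (Adj D x y × Adj D y z × Adj D x z)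

N⁻ : ∀ {n} → Digraph n → Fin n → Subset n
N⁻ D u = tabulate (λ v → D v u)

N⁺ : ∀ {n} → Digraph n → Fin n → Subset n
N⁺ D u = tabulate (λ v → D u v)

N⁺⁺ : ∀ {n} → Digraph n → Fin n → Subset n
N⁺⁺ D u = tabulate (λ v → anyFin (λ w → D u w ∧ D w v) ∧ not (D u v))

IsSullivanVertex : ∀ {n} → Digraph n → Fin n → Set
IsSullivanVertex D u = ∣ N⁺⁺ D u ∣ ≥ ∣ N⁻ D u ∣

{-# OPTIONS --safe #-}
-- Suppose no vertex is a Sullivan vertex. For an arc uw, triangle-freeness gives
-- N⁺(w) ⊆ N⁺⁺(u), hence d⁺(w) + 1 ≤ |N⁺⁺(u)| + 1 ≤ d⁻(u). Summing over all arcs uw,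
-- both Σ d⁺(w) and Σ d⁻(u) count the directed paths of length two, namely Σᵥ d⁻(v) d⁺(v);
-- so the number of arcs is 0. But then d⁻(u) = 0 ≤ |N⁺⁺(u)| for every u.
module Submission where

open import Defs
open import Data.Nat.Properties
open import Algebra.Properties.Semiring.Sum +-*-semiring
  using (sum; sum-syntax; ∑-comm; ∑-distrib-+; *-distribʳ-sum; sum-cong-≗)
open import Data.Bool using (Bool; true; false; _∧_; not; T)
open import Data.Bool.Properties using (T-∧)
open import Data.Empty using (⊥-elim)
open import Data.Fin using (Fin; zero; suc)
open import Data.Fin.Properties using (any?)
open import Data.Fin.Subset using (∣_∣)
open import Data.Nat using (ℕ; zero; suc; _+_; _*_; _≤_; _<_; z≤n; s≤s; _≤?_)
open import Data.Product using (∃; _,_)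
open import Data.Sum using (inj₁)
open import Data.Unit using (tt)
open import Data.Vec using (tabulate)
open import Function using (_∘_; Equivalence)
open import Relation.Nullary using (¬_; yes; no)
open import Relation.Binary.PropositionalEquality

open Equivalence using (from)

indicator : Bool → ℕ
indicator true  = 1
indicator false = 0

indicator-mono : ∀ {a b} → (T a → T b) → indicator a ≤ indicator b
indicator-mono {false} a⇒b = z≤n
indicator-mono {true} {true}  a⇒b = ≤-refl
indicator-mono {true} {false} a⇒b = ⊥-elim (a⇒b tt)

¬T⇒T-not : ∀ {b} → ¬ T b → T (not b)
¬T⇒T-not {false} _  = tt
¬T⇒T-not {true}  ¬b = ¬b tt

T-anyFin : ∀ {n} (p : Fin n → Bool) i → T (p i) → T (anyFin p)
T-anyFin p zero    pᵢ with p zero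
... | true = tt
T-anyFin p (suc i) pᵢ with p zero
... | true  = tt
... | false = T-anyFin (p ∘ suc) i pᵢ

∑-mono-≤ : ∀ {n} {f g : Fin n → ℕ} → (∀ i → f i ≤ g i) → sum f ≤ sum g
∑-mono-≤ {zero}  f≤g = z≤n
∑-mono-≤ {suc n} f≤g = +-mono-≤ (f≤g zero) (∑-mono-≤ (f≤g ∘ suc))

term≤∑ : ∀ {n} (f : Fin n → ℕ) i → f i ≤ sum f
term≤∑ f zero    = m≤m+n _ _
term≤∑ f (suc i) = ≤-trans (term≤∑ (f ∘ suc) i) (m≤n+m _ _)

∣tabulate∣≡∑indicator : ∀ {n} (p : Fin n → Bool) → ∣ tabulate p ∣ ≡ ∑[ i < n ] indicator (p i)
∣tabulate∣≡∑indicator {zero}  p = refl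
∣tabulate∣≡∑indicator {suc n} p with p zero
... | true  = cong suc (∣tabulate∣≡∑indicator (p ∘ suc))
... | false = ∣tabulate∣≡∑indicator (p ∘ suc)

∣tabulate∣-mono : ∀ {n} {p q : Fin n → Bool} → (∀ i → T (p i) → T (q i)) →
                  ∣ tabulate p ∣ ≤ ∣ tabulate q ∣
∣tabulate∣-mono {p = p} {q} p⇒q = begin
  ∣ tabulate p ∣           ≡⟨ ∣tabulate∣≡∑indicator p ⟩
  sum (indicator ∘ p)      ≤⟨ ∑-mono-≤ (λ i → indicator-mono (p⇒q i)) ⟩
  sum (indicator ∘ q)      ≡⟨ ∣tabulate∣≡∑indicator q ⟨
  ∣ tabulate q ∣           ∎
  where open ≤-Reasoning

module _ {n : ℕ} (D : Digraph n) where

  arc : Fin n → Fin n → ℕ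
  arc u v = indicator (D u v)

  outdeg indeg : Fin n → ℕ
  outdeg u = ∑[ v < n ] arc u v
  indeg  v = ∑[ u < n ] arc u v

  arcCount : ℕ
  arcCount = ∑[ u < n ] outdeg u

  ∣N⁻∣≡indeg : ∀ u → ∣ N⁻ D u ∣ ≡ indeg u
  ∣N⁻∣≡indeg u = ∣tabulate∣≡∑indicator (λ v → D v u)

  ∣N⁺∣≡outdeg : ∀ u → ∣ N⁺ D u ∣ ≡ outdeg u
  ∣N⁺∣≡outdeg u = ∣tabulate∣≡∑indicator (D u)

  indeg≤arcCount : ∀ v → indeg v ≤ arcCount
  indeg≤arcCount v = subst (indeg v ≤_) (sym (∑-comm arc)) (term≤∑ indeg v)

  outdeg-head≤∣N⁺⁺-tail∣ : UnderlyingTriangleFree D → ∀ {u w} → Arc D u w →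
                           outdeg w ≤ ∣ N⁺⁺ D u ∣
  outdeg-head≤∣N⁺⁺-tail∣ triangle-free {u} {w} uw =
    subst (_≤ ∣ N⁺⁺ D u ∣) (∣N⁺∣≡outdeg w) (∣tabulate∣-mono two-step)
    where
    two-step : ∀ v → T (D w v) → T (anyFin (λ x → D u x ∧ D x v) ∧ not (D u v))
    two-step v wv = T-∧ .from
      ( T-anyFin (λ x → D u x ∧ D x v) w (T-∧ .from (uw , wv))
      , ¬T⇒T-not (λ uv → triangle-free u w v (inj₁ uw , inj₁ wv , inj₁ uv)) )

  ∑arc*outdeg-head : ∑[ u < n ] ∑[ w < n ] (arc u w * outdeg w) ≡ ∑[ v < n ] (indeg v * outdeg v)
  ∑arc*outdeg-head = begin
    ∑[ u < n ] ∑[ w < n ] (arc u w * outdeg w)  ≡⟨ ∑-comm (λ u w → arc u w * outdeg w) ⟩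
    ∑[ w < n ] ∑[ u < n ] (arc u w * outdeg w)  ≡⟨ sum-cong-≗ (λ w → *-distribʳ-sum (outdeg w) (λ u → arc u w)) ⟨
    ∑[ w < n ] (indeg w * outdeg w)             ∎
    where open ≡-Reasoning

  ∑arc*indeg-tail : ∑[ u < n ] ∑[ w < n ] (arc u w * indeg u) ≡ ∑[ v < n ] (indeg v * outdeg v)
  ∑arc*indeg-tail = sum-cong-≗ row
    where
    open ≡-Reasoning
    row : ∀ u → ∑[ w < n ] (arc u w * indeg u) ≡ indeg u * outdeg u
    row u = begin
      ∑[ w < n ] (arc u w * indeg u)  ≡⟨ *-distribʳ-sum (indeg u) (arc u) ⟨
      outdeg u * indeg u              ≡⟨ *-comm (outdeg u) (indeg u) ⟩
      indeg u * outdeg u              ∎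

  outdeg-head<indeg-tail⇒arcCount≡0 : (∀ {u w} → Arc D u w → outdeg w < indeg u) → arcCount ≡ 0
  outdeg-head<indeg-tail⇒arcCount≡0 out<in = n≤0⇒n≡0 (+-cancelʳ-≤ paths arcCount 0 bound)
    where
    open ≤-Reasoning
    paths : ℕ
    paths = ∑[ v < n ] (indeg v * outdeg v)

    weighted : ∀ u w → arc u w * suc (outdeg w) ≤ arc u w * indeg u
    weighted u w with D u w | out<in {u} {w}
    ... | false | _          = z≤n
    ... | true  | out<inᵘʷ = *-monoʳ-≤ 1 (out<inᵘʷ tt)

    bound : arcCount + paths ≤ paths
    bound = begin
      arcCount + paths
        ≡⟨ cong (arcCount +_) ∑arc*outdeg-head ⟨
      ∑[ u < n ] ∑[ w < n ] arc u w + ∑[ u < n ] ∑[ w < n ] (arc u w * outdeg w)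
        ≡⟨ ∑-distrib-+ outdeg (λ u → ∑[ w < n ] (arc u w * outdeg w)) ⟨
      ∑[ u < n ] (∑[ w < n ] arc u w + ∑[ w < n ] (arc u w * outdeg w))
        ≡⟨ sum-cong-≗ (λ u → ∑-distrib-+ (arc u) (λ w → arc u w * outdeg w)) ⟨
      ∑[ u < n ] ∑[ w < n ] (arc u w + arc u w * outdeg w)
        ≡⟨ sum-cong-≗ (λ u → sum-cong-≗ (λ w → *-suc (arc u w) (outdeg w))) ⟨
      ∑[ u < n ] ∑[ w < n ] (arc u w * suc (outdeg w))
        ≤⟨ ∑-mono-≤ (λ u → ∑-mono-≤ (weighted u)) ⟩
      ∑[ u < n ] ∑[ w < n ] (arc u w * indeg u)
        ≡⟨ ∑arc*indeg-tail ⟩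
      paths ∎

sullivan-vertex : ∀ {n} (D : Digraph (suc n)) → UnderlyingTriangleFree D → ∃ (IsSullivanVertex D)
sullivan-vertex D triangle-free with any? (λ u → ∣ N⁻ D u ∣ ≤? ∣ N⁺⁺ D u ∣)
... | yes sullivan = sullivan
... | no  none     = ⊥-elim (<-irrefl refl (begin-strict
  0                  ≤⟨ z≤n ⟩
  ∣ N⁺⁺ D zero ∣     <⟨ ∣N⁺⁺∣<indeg zero ⟩
  indeg D zero       ≤⟨ indeg≤arcCount D zero ⟩
  arcCount D         ≡⟨ outdeg-head<indeg-tail⇒arcCount≡0 D out<in ⟩
  0                  ∎))
  where
  open ≤-Reasoning
  ∣N⁺⁺∣<indeg : ∀ u → ∣ N⁺⁺ D u ∣ < indeg D u
  ∣N⁺⁺∣<indeg u = subst (∣ N⁺⁺ D u ∣ <_) (∣N⁻∣≡indeg D u) (≰⇒> (λ s → none (u , s)))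
  out<in : ∀ {u w} → Arc D u w → outdeg D w < indeg D u
  out<in {u} uw = <-≤-trans (s≤s (outdeg-head≤∣N⁺⁺-tail∣ D triangle-free uw)) (∣N⁺⁺∣<indeg u)

corollary3p3 : (n : ℕ) (D : Digraph (suc n)) → IsOriented D → UnderlyingTriangleFree D →
    ∃ λ (u : Fin (suc n)) → IsSullivanVertex D u
corollary3p3 n D _ = sullivan-vertex D
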